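{- Let $\lambda\in\mathbb{C}$ with $\lambda\neq 1$, let $r,k\in\mathbb{Z}$, $s\in\mathbb{Z}_{\geq 0}$ and $n\geq 0$. Then \[ T_{n}^{(r,k)}(x|\lambda)=\sum_{m=0}^{n}\left\{ \binom{n}{m} \sum_{l=0}^{n-m}\frac{\binom{n-m}{l}}{\binom{s+l}{l}}S_{2}(l+s,s)T_{n-m-l}^{(r,k)}(\lambda) \right\} \mathbb{B}^{(s)}_{m}(x). \]
   Context: For $k\in\mathbb{Z}$, $Li_k(x)=\sum_{n\ge1}x^n/n^k$. For $r,k\in\mathbb{Z}$ the polynomials $T_n^{(r,k)}(x|\lambda)$ are defined by $\left(\frac{1-\lambda}{e^t-\lambda}\right)^r\frac{Li_{k}(1-e^{ -t})}{1-e^{ -t}}e^{xt}=\sum_{n\ge0}T_n^{(r,k)}(x|\lambda)\frac{t^n}{n!}$ (as formal power series in $t$), and $T_n^{(r,k)}(\lambda)=T_n^{(r,k)}(0|\lambda)$. The Bernoulli polynomials of order $s$ are defined by $\left(\frac{t}{e^t-1}\right)^{s}e^{xt}=\sum_{n\ge0}\mathbb{B}_n^{(s)}(x)\frac{t^n}{n!}$. $S_2(l,m)$ denotes the Stirling numbers of the second kind, $(e^t-1)^m=m!\sum_{l\ge m}S_2(l,m)\frac{t^l}{l!}$. -}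

module Defs where

open import Level using (Level; _⊔_) renaming (suc to lsuc)
open import Algebra.Bundles using (CommutativeRing)
open import Data.Nat as ℕ using (ℕ; zero; suc; _∸_; _≤?_; _!)
open import Data.Nat.Combinatorics using (_C_)
open import Data.Integer as ℤ using (ℤ; +_; -[1+_])
open import Relation.Nullary using (¬_; yes; no)

ringFromℕ : ∀ {c ℓ} (R : CommutativeRing c ℓ) → ℕ → CommutativeRing.Carrier R
ringFromℕ R zero    = CommutativeRing.0# R
ringFromℕ R (suc n) = CommutativeRing._+_ R (CommutativeRing.1# R) (ringFromℕ R n)

-- A field of characteristic zero (e.g. ℂ).  The inverse is total, with
-- x ⁻¹ only specified for x ≉ 0 (the value 0 ⁻¹ is irrelevant).
record CharZeroField (c ℓ : Level) : Set (lsuc (c ⊔ ℓ)) where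
  field
    cring       : CommutativeRing c ℓ
  open CommutativeRing cring
  field
    _⁻¹        : Carrier → Carrier
    ⁻¹-cong    : ∀ {x y} → x ≈ y → x ⁻¹ ≈ y ⁻¹
    ⁻¹-inverse : ∀ x → ¬ (x ≈ 0#) → x * (x ⁻¹) ≈ 1#
    charZero   : ∀ n → ¬ (ringFromℕ cring (suc n) ≈ 0#)

S₂ : ℕ → ℕ → ℕ
S₂ zero    zero    = 1
S₂ zero    (suc m) = 0
S₂ (suc l) zero    = 0
S₂ (suc l) (suc m) = suc m ℕ.* S₂ l (suc m) ℕ.+ S₂ l m

module Series {c ℓ : Level} (F : CharZeroField c ℓ) where
  open CharZeroField F
  open CommutativeRing cring

  K : Set c
  K = Carrier

  fromℕ : ℕ → K
  fromℕ = ringFromℕ cring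

  _^_ : K → ℕ → K
  a ^ zero  = 1#
  a ^ suc m = (a ^ m) * a

  zpow : K → ℤ → K
  zpow a (+ m)     = a ^ m
  zpow a -[1+ m ]  = (a ^ suc m) ⁻¹

  sumTo : ℕ → (ℕ → K) → K
  sumTo zero    f = 0#
  sumTo (suc n) f = sumTo n f + f n

  fact : ℕ → K
  fact n = fromℕ (n !)

  -- formal power series in t: n ↦ coefficient of t^n
  FPS : Set c
  FPS = ℕ → K

  oneS : FPS
  oneS zero    = 1#
  oneS (suc n) = 0#

  constS : K → FPS
  constS a n = a * oneS n

  _⊕_ : FPS → FPS → FPS
  (f ⊕ g) n = f n + g n

  _⊖_ : FPS → FPS → FPS
  (f ⊖ g) n = f n - g n

  scalS : K → FPS → FPS
  scalS a f n = a * f n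

  _⊛_ : FPS → FPS → FPS
  (f ⊛ g) n = sumTo (suc n) (λ i → f i * g (n ∸ i))

  powS : FPS → ℕ → FPS
  powS f zero    = oneS
  powS f (suc m) = powS f m ⊛ f

  -- multiplicative inverse of a power series with invertible constant term:
  -- g 0 = (f 0)⁻¹,  g N = - (f 0)⁻¹ * Σ_{j<N} f (N - j) * g j
  private
    invUpTo : FPS → ℕ → FPS
    invUpTo f zero    m = (f 0) ⁻¹
    invUpTo f (suc n) m with m ℕ.≤? n
    ... | yes _ = invUpTo f n m
    ... | no  _ = - ((f 0) ⁻¹) * sumTo (suc n) (λ j → f (suc n ∸ j) * invUpTo f n j)

  invS : FPS → FPS
  invS f n = invUpTo f n n

  zpowS : FPS → ℤ → FPS
  zpowS f (+ m)    = powS f m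
  zpowS f -[1+ m ] = powS (invS f) (suc m)

  -- division by t of a series with zero constant term
  divT : FPS → FPS
  divT f n = f (suc n)

  -- composition g(y(t)) of g(u) = Σ g_j u^j with y having zero constant term
  compS : FPS → FPS → FPS
  compS g y n = sumTo (suc n) (λ j → g j * powS y j n)

  expS : K → FPS
  expS a n = (a ^ n) * (fact n) ⁻¹

  Li : ℤ → FPS
  Li k zero    = 0#
  Li k (suc n) = zpow (fromℕ (suc n)) (ℤ.- k)

  TGen : K → ℤ → ℤ → K → FPS
  TGen λ' r k x =
    (zpowS (scalS (1# - λ') (invS (expS 1# ⊖ constS λ'))) r
      ⊛ compS (divT (Li k)) (oneS ⊖ expS (- 1#)))
      ⊛ expS x

  T : K → ℤ → ℤ → ℕ → K → K
  T λ' r k n x = fact n * TGen λ' r k x n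

  T₀ : K → ℤ → ℤ → ℕ → K
  T₀ λ' r k n = T λ' r k n 0#

  -- Bernoulli polynomials of order s:  (t/(e^t - 1))^s e^{xt}
  B : ℕ → ℕ → K → K
  B s m x = fact m * (powS (invS (divT (expS 1# ⊖ oneS))) s ⊛ expS x) m

-- Let U = ((e^t - 1)/t)^s, so that U⁻¹ e^{xt} generates the Bernoulli polynomials of
-- order s.  For any power series A, A e^{xt} = (U⁻¹ e^{xt}) (U A), and multiplying
-- exponential generating functions convolves coefficients binomially:
-- n! [t^n] A e^{xt} = Σ_m C(n,m) · (n-m)! [t^{n-m}] (U A) · B_m(x), where in turn
-- (n-m)! [t^{n-m}] (U A) is a binomial convolution of l! [t^l] U = S₂(l+s,s) / C(s+l,l)
-- with the j! [t^j] A.  The value of l! [t^l] U comes by induction on s from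
-- U_{s+1} = U_s · (e^t - 1)/t and the recurrence Σ_{j ≤ N} C(N,j) S₂(j,k) = S₂(N+1,k+1).
{-# OPTIONS --safe #-}
module Submission where

open import Defs
open import Level using (Level)
open import Algebra.Bundles using (CommutativeRing; CommutativeMonoid)
open import Data.Nat as ℕ
  using (ℕ; zero; suc; _∸_; _≤_; _<_; z≤n; s≤s⁻¹; _!)
  renaming (_+_ to _+ℕ_; _*_ to _*ℕ_)
import Data.Nat.Properties as ℕ
open import Data.Nat.Combinatorics
  using (_C_; nCk≡n!/k![n-k]!; k![n∸k]!∣n!; nCn≡1; k>n⇒nCk≡0; nCk+nC[k+1]≡[n+1]C[k+1])
open import Data.Nat.DivMod using (m/n*n≡m)
open import Data.Integer using (ℤ)
open import Data.Empty using (⊥-elim)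
open import Data.Product using (_,_)
open import Relation.Nullary using (¬_; yes; no)
import Relation.Binary.PropositionalEquality as ≡
open ≡ using (_≡_)
import Algebra.Properties.CommutativeSemigroup as CommutativeSemigroupProperties

module _ {c ℓ : Level} (F : CharZeroField c ℓ) where
  open CharZeroField F
  open CommutativeRing cring
  open Series F
  open import Relation.Binary.Reasoning.Setoid setoid
  open import Algebra.Properties.Ring ring using (-‿distribˡ-*; -0#≈0#)
  open import Algebra.Properties.Group +-group using (∙-cancelʳ)
  open import Algebra.Solver.Ring.NaturalCoefficients.Default commutativeSemiring
    using (solve; _:=_; con; _:+_; _:*_)
  open CommutativeSemigroupProperties +-commutativeSemigroup
    using () renaming (interchange to +-interchange; x∙yz≈y∙xz to x+[y+z]≈y+[x+z])
  open CommutativeSemigroupProperties *-commutativeSemigroup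
    using () renaming (xy∙z≈xz∙y to [x*y]*z≈[x*z]*y; x∙yz≈y∙xz to x*[y*z]≈y*[x*z]; xy∙z≈y∙zx to [x*y]*z≈y*[z*x])

  -- Finite sums

  sumTo-cong-< : ∀ n {f g : ℕ → K} → (∀ i → i < n → f i ≈ g i) → sumTo n f ≈ sumTo n g
  sumTo-cong-< zero    f≈g = refl
  sumTo-cong-< (suc n) f≈g =
    +-cong (sumTo-cong-< n (λ i i<n → f≈g i (ℕ.m<n⇒m<1+n i<n))) (f≈g n (ℕ.n<1+n n))

  sumTo-cong : ∀ n {f g : ℕ → K} → (∀ i → f i ≈ g i) → sumTo n f ≈ sumTo n g
  sumTo-cong n f≈g = sumTo-cong-< n (λ i _ → f≈g i)

  sumTo-zero : ∀ n {f : ℕ → K} → (∀ i → i < n → f i ≈ 0#) → sumTo n f ≈ 0#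
  sumTo-zero n f≈0 = trans (sumTo-cong-< n f≈0) (sumTo-0# n)
    where
    sumTo-0# : ∀ n → sumTo n (λ _ → 0#) ≈ 0#
    sumTo-0# zero    = refl
    sumTo-0# (suc n) = trans (+-identityʳ _) (sumTo-0# n)

  sumTo-+ : ∀ n {f g : ℕ → K} → sumTo n (λ i → f i + g i) ≈ sumTo n f + sumTo n g
  sumTo-+ zero    = sym (+-identityʳ 0#)
  sumTo-+ (suc n) = trans (+-cong (sumTo-+ n) refl) (+-interchange _ _ _ _)

  *-distribˡ-sumTo : ∀ n a {f : ℕ → K} → a * sumTo n f ≈ sumTo n (λ i → a * f i)
  *-distribˡ-sumTo zero    a = zeroʳ a
  *-distribˡ-sumTo (suc n) a = trans (distribˡ a _ _) (+-cong (*-distribˡ-sumTo n a) refl)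

  *-distribʳ-sumTo : ∀ n a {f : ℕ → K} → sumTo n f * a ≈ sumTo n (λ i → f i * a)
  *-distribʳ-sumTo zero    a = zeroˡ a
  *-distribʳ-sumTo (suc n) a = trans (distribʳ a _ _) (+-cong (*-distribʳ-sumTo n a) refl)

  sumTo-shift : ∀ n {f : ℕ → K} → sumTo (suc n) f ≈ f 0 + sumTo n (λ i → f (suc i))
  sumTo-shift zero    = trans (+-identityˡ _) (sym (+-identityʳ _))
  sumTo-shift (suc n) = trans (+-cong (sumTo-shift n) refl) (+-assoc _ _ _)

  sumTo-reverse : ∀ n {f : ℕ → K} → sumTo (suc n) f ≈ sumTo (suc n) (λ i → f (n ∸ i))
  sumTo-reverse zero        = refl
  sumTo-reverse (suc n) {f} = begin
    sumTo (suc n) f + f (suc n)                  ≈⟨ +-cong (sumTo-reverse n) refl ⟩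
    sumTo (suc n) (λ i → f (n ∸ i)) + f (suc n)  ≈⟨ +-comm _ _ ⟩
    f (suc n) + sumTo (suc n) (λ i → f (n ∸ i))  ≈⟨ sumTo-shift (suc n) ⟨
    sumTo (suc (suc n)) (λ i → f (suc n ∸ i))    ∎

  sumTo-split : ∀ m n {f : ℕ → K} →
                sumTo (m +ℕ n) f ≈ sumTo m f + sumTo n (λ i → f (m +ℕ i))
  sumTo-split m zero    rewrite ℕ.+-identityʳ m = sym (+-identityʳ _)
  sumTo-split m (suc n) rewrite ℕ.+-suc m n =
    trans (+-cong (sumTo-split m n) refl) (+-assoc _ _ _)

  sumTo-triangle : ∀ n (G : ℕ → ℕ → K) →
                   sumTo (suc n) (λ i → sumTo (suc i) (λ a → G a (i ∸ a))) ≈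
                   sumTo (suc n) (λ a → sumTo (suc (n ∸ a)) (G a))
  sumTo-triangle zero    G = refl
  sumTo-triangle (suc n) G = begin
    sumTo (suc n) (λ i → sumTo (suc i) (λ a → G a (i ∸ a))) + (diagonal + G (suc n) (n ∸ n))
      ≈⟨ +-cong (sumTo-triangle n G) refl ⟩
    rows + (diagonal + G (suc n) (n ∸ n))
      ≈⟨ +-assoc _ _ _ ⟨
    (rows + diagonal) + G (suc n) (n ∸ n)
      ≈⟨ +-cong (sym (sumTo-+ (suc n))) (sym (lastRow n)) ⟩
    sumTo (suc n) (λ a → sumTo (suc (n ∸ a)) (G a) + G a (suc n ∸ a))
      + sumTo (suc (n ∸ n)) (G (suc n))
      ≈⟨ +-cong (sumTo-cong-< (suc n) (λ a a≤n → extendRow a (s≤s⁻¹ a≤n))) refl ⟩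
    sumTo (suc (suc n)) (λ a → sumTo (suc (suc n ∸ a)) (G a)) ∎
    where
    rows diagonal : K
    rows     = sumTo (suc n) (λ a → sumTo (suc (n ∸ a)) (G a))
    diagonal = sumTo (suc n) (λ a → G a (suc n ∸ a))
    extendRow : ∀ a → a ≤ n →
                sumTo (suc (n ∸ a)) (G a) + G a (suc n ∸ a) ≈ sumTo (suc (suc n ∸ a)) (G a)
    extendRow a a≤n rewrite ℕ.+-∸-assoc 1 a≤n = refl
    lastRow : ∀ n → sumTo (suc (n ∸ n)) (G (suc n)) ≈ G (suc n) (n ∸ n)
    lastRow n rewrite ℕ.n∸n≡0 n = +-identityˡ _

  -- Formal power series under the Cauchy product

  infix 4 _≋_
  _≋_ : FPS → FPS → Set ℓ
  f ≋ g = ∀ n → f n ≈ g n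

  ≋-refl : ∀ {f} → f ≋ f
  ≋-refl n = refl

  ≋-sym : ∀ {f g} → f ≋ g → g ≋ f
  ≋-sym f≋g n = sym (f≋g n)

  ≋-trans : ∀ {f g h} → f ≋ g → g ≋ h → f ≋ h
  ≋-trans f≋g g≋h n = trans (f≋g n) (g≋h n)

  ⊛-cong : ∀ f f′ g g′ → f ≋ f′ → g ≋ g′ → f ⊛ g ≋ f′ ⊛ g′
  ⊛-cong f f′ g g′ f≋f′ g≋g′ n = sumTo-cong (suc n) (λ i → *-cong (f≋f′ i) (g≋g′ (n ∸ i)))

  ⊛-comm : ∀ f g → f ⊛ g ≋ g ⊛ f
  ⊛-comm f g n = begin
    sumTo (suc n) (λ i → f i * g (n ∸ i))              ≈⟨ sumTo-reverse n ⟩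
    sumTo (suc n) (λ i → f (n ∸ i) * g (n ∸ (n ∸ i)))  ≈⟨ sumTo-cong-< (suc n) swap ⟩
    sumTo (suc n) (λ i → g i * f (n ∸ i))              ∎
    where
    swap : ∀ i → i < suc n → f (n ∸ i) * g (n ∸ (n ∸ i)) ≈ g i * f (n ∸ i)
    swap i i≤n rewrite ℕ.m∸[m∸n]≡n (s≤s⁻¹ i≤n) = *-comm _ _

  ⊛-identityˡ : ∀ f → oneS ⊛ f ≋ f
  ⊛-identityˡ f n = begin
    sumTo (suc n) (λ i → oneS i * f (n ∸ i))        ≈⟨ sumTo-shift n ⟩
    1# * f n + sumTo n (λ i → 0# * f (n ∸ suc i))  ≈⟨ +-cong (*-identityˡ _) (sumTo-zero n (λ i _ → zeroˡ _)) ⟩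
    f n + 0#                                       ≈⟨ +-identityʳ _ ⟩
    f n                                            ∎

  ⊛-identityʳ : ∀ f → f ⊛ oneS ≋ f
  ⊛-identityʳ f = ≋-trans (⊛-comm f oneS) (⊛-identityˡ f)

  ⊛-assoc : ∀ f g h → (f ⊛ g) ⊛ h ≋ f ⊛ (g ⊛ h)
  ⊛-assoc f g h n = begin
    sumTo (suc n) (λ i → sumTo (suc i) (λ a → f a * g (i ∸ a)) * h (n ∸ i))
      ≈⟨ sumTo-cong (suc n) (λ i → *-distribʳ-sumTo (suc i) (h (n ∸ i))) ⟩
    sumTo (suc n) (λ i → sumTo (suc i) (λ a → f a * g (i ∸ a) * h (n ∸ i)))
      ≈⟨ sumTo-cong (suc n) (λ i → sumTo-cong-< (suc i) (λ a a≤i → reindex i a (s≤s⁻¹ a≤i))) ⟩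
    sumTo (suc n) (λ i → sumTo (suc i) (λ a → term a (i ∸ a)))
      ≈⟨ sumTo-triangle n term ⟩
    sumTo (suc n) (λ a → sumTo (suc (n ∸ a)) (λ b → f a * g b * h (n ∸ a ∸ b)))
      ≈⟨ sumTo-cong (suc n) (λ a → trans (sumTo-cong (suc (n ∸ a)) (λ b → *-assoc _ _ _))
                                         (sym (*-distribˡ-sumTo (suc (n ∸ a)) (f a)))) ⟩
    sumTo (suc n) (λ a → f a * sumTo (suc (n ∸ a)) (λ b → g b * h (n ∸ a ∸ b))) ∎
    where
    term : ℕ → ℕ → K
    term a b = f a * g b * h (n ∸ a ∸ b)
    reindex : ∀ i a → a ≤ i → f a * g (i ∸ a) * h (n ∸ i) ≈ term a (i ∸ a)
    reindex i a a≤i rewrite ℕ.∸-+-assoc n a (i ∸ a) | ℕ.m+[n∸m]≡n a≤i = refl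

  ⊛-commutativeMonoid : CommutativeMonoid c ℓ
  ⊛-commutativeMonoid = record
    { Carrier = FPS
    ; _≈_     = _≋_
    ; _∙_     = _⊛_
    ; ε       = oneS
    ; isCommutativeMonoid = record
      { isMonoid = record
        { isSemigroup = record
          { isMagma = record
            { isEquivalence = record { refl = ≋-refl ; sym = ≋-sym ; trans = ≋-trans }
            ; ∙-cong        = λ {f} {f′} {g} {g′} → ⊛-cong f f′ g g′
            }
          ; assoc = ⊛-assoc
          }
        ; identity = ⊛-identityˡ , ⊛-identityʳ
        }
      ; comm = ⊛-comm
      }
    }

  open CommutativeSemigroupProperties
         (CommutativeMonoid.commutativeSemigroup ⊛-commutativeMonoid)
    using () renaming (interchange to ⊛-interchange)

  powS-cong : ∀ f g s → f ≋ g → powS f s ≋ powS g s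
  powS-cong f g zero    f≋g = ≋-refl
  powS-cong f g (suc s) f≋g = ⊛-cong (powS f s) (powS g s) f g (powS-cong f g s f≋g) f≋g

  powS-oneS : ∀ s → powS oneS s ≋ oneS
  powS-oneS zero    = ≋-refl
  powS-oneS (suc s) =
    ≋-trans (⊛-cong (powS oneS s) oneS oneS oneS (powS-oneS s) ≋-refl) (⊛-identityˡ oneS)

  powS-⊛ : ∀ f g s → powS (f ⊛ g) s ≋ powS f s ⊛ powS g s
  powS-⊛ f g zero    = ≋-sym (⊛-identityˡ oneS)
  powS-⊛ f g (suc s) =
    ≋-trans (⊛-cong (powS (f ⊛ g) s) (powS f s ⊛ powS g s) (f ⊛ g) (f ⊛ g) (powS-⊛ f g s) ≋-refl)
            (⊛-interchange (powS f s) (powS g s) f g)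

  mutual
    -- `Series.invUpTo` is private to `Defs`; this meta is solved to it by unfolding `invS` below.
    invApprox : FPS → ℕ → ℕ → K
    invApprox = _

    invS-suc-≡ : ∀ f n → invS f (suc n) ≡
                 - ((f 0) ⁻¹) * sumTo (suc n) (λ j → f (suc n ∸ j) * invApprox f n j)
    invS-suc-≡ f n with suc n ℕ.≤? n
    ... | yes n<n = ⊥-elim (ℕ.n≮n n n<n)
    ... | no  _   = ≡.refl

  invApprox-stable : ∀ f n m → m ≤ n → invApprox f n m ≡ invS f m
  invApprox-stable f zero    zero z≤n = ≡.refl
  invApprox-stable f (suc n) m m≤1+n with m ℕ.≤? n
  ... | yes m≤n = invApprox-stable f n m m≤n
  ... | no  m≰n = ≡.sym (≡.trans (≡.cong (invS f) (ℕ.≤-antisym m≤1+n (ℕ.≰⇒> m≰n))) (invS-suc-≡ f n))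

  invS-suc : ∀ f n →
             invS f (suc n) ≈ - ((f 0) ⁻¹) * sumTo (suc n) (λ j → f (suc n ∸ j) * invS f j)
  invS-suc f n = trans (reflexive (invS-suc-≡ f n))
    (*-cong refl (sumTo-cong-< (suc n) (λ j j≤n →
      *-cong refl (reflexive (invApprox-stable f n j (s≤s⁻¹ j≤n))))))

  invS-inverseˡ : ∀ f → ¬ (f 0 ≈ 0#) → invS f ⊛ f ≋ oneS
  invS-inverseˡ f f0≉0 zero = trans (+-identityˡ _) (trans (*-comm _ _) (⁻¹-inverse (f 0) f0≉0))
  invS-inverseˡ f f0≉0 (suc n) = begin
    S + invS f (suc n) * f (n ∸ n)
      ≈⟨ +-cong refl (*-cong (invS-suc f n) (reflexive (≡.cong f (ℕ.n∸n≡0 n)))) ⟩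
    S + (- i * S′) * f 0
      ≈⟨ +-cong refl (*-cong (*-cong refl S′≈S) refl) ⟩
    S + (- i * S) * f 0
      ≈⟨ +-cong refl (trans (*-cong (sym (-‿distribˡ-* i S)) refl) (sym (-‿distribˡ-* (i * S) (f 0)))) ⟩
    S + - (i * S * f 0)
      ≈⟨ +-cong refl (-‿cong (trans ([x*y]*z≈y*[z*x] i S (f 0)) (trans (*-cong refl (⁻¹-inverse (f 0) f0≉0)) (*-identityʳ S)))) ⟩
    S + - S
      ≈⟨ -‿inverseʳ S ⟩
    0# ∎
    where
    i S S′ : K
    i  = (f 0) ⁻¹
    S  = sumTo (suc n) (λ j → invS f j * f (suc n ∸ j))
    S′ = sumTo (suc n) (λ j → f (suc n ∸ j) * invS f j)
    S′≈S : S′ ≈ S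
    S′≈S = sumTo-cong (suc n) (λ j → *-comm _ _)

  powS-invS-⊛-powS : ∀ f → ¬ (f 0 ≈ 0#) → ∀ s → powS (invS f) s ⊛ powS f s ≋ oneS
  powS-invS-⊛-powS f f0≉0 s =
    ≋-trans (≋-sym (powS-⊛ (invS f) f s))
            (≋-trans (powS-cong (invS f ⊛ f) oneS s (invS-inverseˡ f f0≉0)) (powS-oneS s))

  -- Factorials and exponential series

  fromℕ-cong : ∀ {a b} → a ≡ b → fromℕ a ≈ fromℕ b
  fromℕ-cong a≡b = reflexive (≡.cong fromℕ a≡b)

  fromℕ-+ : ∀ a b → fromℕ (a +ℕ b) ≈ fromℕ a + fromℕ b
  fromℕ-+ zero    b = sym (+-identityˡ _)
  fromℕ-+ (suc a) b = trans (+-cong refl (fromℕ-+ a b)) (sym (+-assoc _ _ _))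

  fromℕ-* : ∀ a b → fromℕ (a *ℕ b) ≈ fromℕ a * fromℕ b
  fromℕ-* zero    b = sym (zeroˡ _)
  fromℕ-* (suc a) b = begin
    fromℕ (b +ℕ a *ℕ b)          ≈⟨ fromℕ-+ b (a *ℕ b) ⟩
    fromℕ b + fromℕ (a *ℕ b)     ≈⟨ +-cong (sym (*-identityˡ _)) (fromℕ-* a b) ⟩
    1# * fromℕ b + fromℕ a * fromℕ b  ≈⟨ distribʳ _ _ _ ⟨
    (1# + fromℕ a) * fromℕ b     ∎

  fromℕ-nonZero : ∀ n → .{{ℕ.NonZero n}} → ¬ (fromℕ n ≈ 0#)
  fromℕ-nonZero (suc n) = charZero n

  fact≉0 : ∀ m → ¬ (fact m ≈ 0#)
  fact≉0 m = fromℕ-nonZero (m !) {{ℕ._!≢0 m}}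

  fact-binomial : ∀ n k → k ≤ n → fact n ≈ fromℕ (n C k) * (fact k * fact (n ∸ k))
  fact-binomial n k k≤n = begin
    fromℕ (n !)                                 ≈⟨ fromℕ-cong (≡.sym n!≡nCk*[k!*[n∸k]!]) ⟩
    fromℕ ((n C k) *ℕ (k ! *ℕ (n ∸ k) !))       ≈⟨ fromℕ-* (n C k) _ ⟩
    fromℕ (n C k) * fromℕ (k ! *ℕ (n ∸ k) !)    ≈⟨ *-cong refl (fromℕ-* (k !) ((n ∸ k) !)) ⟩
    fromℕ (n C k) * (fact k * fact (n ∸ k))     ∎
    where
    n!≡nCk*[k!*[n∸k]!] : (n C k) *ℕ (k ! *ℕ (n ∸ k) !) ≡ n !
    n!≡nCk*[k!*[n∸k]!] =
      ≡.trans (≡.cong (_*ℕ (k ! *ℕ (n ∸ k) !)) (nCk≡n!/k![n-k]! k≤n))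
              (m/n*n≡m {{ℕ._!*_!≢0 k (n ∸ k)}} (k![n∸k]!∣n! k≤n))

  ⁻¹-cancelˡ : ∀ {a} x → ¬ (a ≈ 0#) → a ⁻¹ * (a * x) ≈ x
  ⁻¹-cancelˡ {a} x a≉0 = begin
    a ⁻¹ * (a * x)   ≈⟨ *-assoc _ _ _ ⟨
    a ⁻¹ * a * x     ≈⟨ *-cong (trans (*-comm _ _) (⁻¹-inverse a a≉0)) refl ⟩
    1# * x           ≈⟨ *-identityˡ x ⟩
    x                ∎

  *-cancelˡ-≉0 : ∀ {a} x y → ¬ (a ≈ 0#) → a * x ≈ a * y → x ≈ y
  *-cancelˡ-≉0 x y a≉0 ax≈ay =
    trans (sym (⁻¹-cancelˡ x a≉0)) (trans (*-cong refl ax≈ay) (⁻¹-cancelˡ y a≉0))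

  a*x≈y⇒x≈a⁻¹*y : ∀ {a} x y → ¬ (a ≈ 0#) → a * x ≈ y → x ≈ a ⁻¹ * y
  a*x≈y⇒x≈a⁻¹*y x y a≉0 ax≈y = trans (sym (⁻¹-cancelˡ x a≉0)) (*-cong refl ax≈y)

  fact-*-⊛ : ∀ f g n → fact n * (f ⊛ g) n ≈
             sumTo (suc n) (λ m → fromℕ (n C m) * (fact m * f m) * (fact (n ∸ m) * g (n ∸ m)))
  fact-*-⊛ f g n = trans (*-distribˡ-sumTo (suc n) (fact n))
                         (sumTo-cong-< (suc n) (λ m m≤n → term m (s≤s⁻¹ m≤n)))
    where
    regroup : ∀ b u v x y → (b * (u * v)) * (x * y) ≈ b * (u * x) * (v * y)
    regroup = solve 5 (λ b u v x y → (b :* (u :* v)) :* (x :* y) := b :* (u :* x) :* (v :* y)) refl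
    term : ∀ m → m ≤ n → fact n * (f m * g (n ∸ m)) ≈
           fromℕ (n C m) * (fact m * f m) * (fact (n ∸ m) * g (n ∸ m))
    term m m≤n = trans (*-cong (fact-binomial n m m≤n) refl) (regroup _ _ _ _ _)

  expS-0#≋oneS : expS 0# ≋ oneS
  expS-0#≋oneS zero    = begin
    1# * fact 0 ⁻¹        ≈⟨ *-cong (sym (+-identityʳ 1#)) refl ⟩
    fact 0 * fact 0 ⁻¹    ≈⟨ ⁻¹-inverse (fact 0) (fact≉0 0) ⟩
    1#                    ∎
  expS-0#≋oneS (suc n) = trans (*-cong (zeroʳ _) refl) (zeroˡ _)

  ⊛-expS-0# : ∀ f → f ⊛ expS 0# ≋ f
  ⊛-expS-0# f = ≋-trans (⊛-cong f f (expS 0#) oneS ≋-refl expS-0#≋oneS) (⊛-identityʳ f)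

  expm1/t : FPS
  expm1/t = divT (expS 1# ⊖ oneS)

  1#^ : ∀ m → 1# ^ m ≈ 1#
  1#^ zero    = refl
  1#^ (suc m) = trans (*-identityʳ _) (1#^ m)

  fact-suc-*-expm1/t : ∀ m → fact (suc m) * expm1/t m ≈ 1#
  fact-suc-*-expm1/t m = begin
    fact (suc m) * ((1# ^ suc m) * fact (suc m) ⁻¹ - 0#)
      ≈⟨ *-cong refl (trans (+-cong refl -0#≈0#) (+-identityʳ _)) ⟩
    fact (suc m) * ((1# ^ suc m) * fact (suc m) ⁻¹)
      ≈⟨ *-cong refl (trans (*-cong (1#^ (suc m)) refl) (*-identityˡ _)) ⟩
    fact (suc m) * fact (suc m) ⁻¹
      ≈⟨ ⁻¹-inverse _ (fact≉0 (suc m)) ⟩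
    1# ∎

  expm1/t-0≉0 : ¬ (expm1/t 0 ≈ 0#)
  expm1/t-0≉0 e0≈0 = charZero 0 (begin
    1# + 0#              ≈⟨ +-identityʳ 1# ⟩
    1#                   ≈⟨ fact-suc-*-expm1/t 0 ⟨
    fact 1 * expm1/t 0   ≈⟨ *-cong refl e0≈0 ⟩
    fact 1 * 0#          ≈⟨ zeroʳ _ ⟩
    0#                   ∎)

  -- Stirling numbers of the second kind

  S₂-< : ∀ {j s} → j < s → S₂ j s ≡ 0
  S₂-< {zero}  {suc s} _     = ≡.refl
  S₂-< {suc j} {suc s} 1+j<1+s
    rewrite S₂-< {j} {suc s} (ℕ.m<n⇒m<1+n (ℕ.s<s⁻¹ 1+j<1+s)) | S₂-< {j} {s} (ℕ.s<s⁻¹ 1+j<1+s)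
    = ≡.trans (ℕ.+-identityʳ _) (ℕ.*-zeroʳ (suc s))

  fromℕ-S₂-suc : ∀ N k → fromℕ (S₂ (suc N) (suc k)) ≈
                 fromℕ (suc k) * fromℕ (S₂ N (suc k)) + fromℕ (S₂ N k)
  fromℕ-S₂-suc N k =
    trans (fromℕ-+ (suc k *ℕ S₂ N (suc k)) (S₂ N k)) (+-cong (fromℕ-* (suc k) (S₂ N (suc k))) refl)

  fromℕ-pascal : ∀ N j → fromℕ (suc N C suc j) ≈ fromℕ (N C j) + fromℕ (N C suc j)
  fromℕ-pascal N j =
    trans (fromℕ-cong (≡.sym (nCk+nC[k+1]≡[n+1]C[k+1] N j))) (fromℕ-+ (N C j) (N C suc j))

  sumTo-binomial-pascal : ∀ N (h : ℕ → K) →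
    sumTo (suc (suc N)) (λ j → fromℕ (suc N C j) * h j) ≈
    sumTo (suc N) (λ j → fromℕ (N C j) * h (suc j)) + sumTo (suc N) (λ j → fromℕ (N C j) * h j)
  sumTo-binomial-pascal N h = begin
    sumTo (suc (suc N)) (λ j → fromℕ (suc N C j) * h j)
      ≈⟨ sumTo-shift (suc N) ⟩
    first + sumTo (suc N) (λ j → fromℕ (suc N C suc j) * h (suc j))
      ≈⟨ +-cong refl (trans (sumTo-cong (suc N) (λ j → trans (*-cong (fromℕ-pascal N j) refl)
                                                              (distribʳ _ _ _)))
                            (sumTo-+ (suc N))) ⟩
    first + (X + sumTo (suc N) (λ j → g (suc j)))
      ≈⟨ x+[y+z]≈y+[x+z] _ _ _ ⟩
    X + (first + sumTo (suc N) (λ j → g (suc j)))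
      ≈⟨ +-cong refl (sumTo-shift (suc N)) ⟨
    X + (sumTo (suc N) g + g (suc N))
      ≈⟨ +-cong refl (trans (+-cong refl g[1+N]≈0) (+-identityʳ _)) ⟩
    X + sumTo (suc N) g ∎
    where
    first X : K
    first = fromℕ (suc N C 0) * h 0
    g : ℕ → K
    g j = fromℕ (N C j) * h j
    X = sumTo (suc N) (λ j → fromℕ (N C j) * h (suc j))
    g[1+N]≈0 : g (suc N) ≈ 0#
    g[1+N]≈0 = trans (*-cong (fromℕ-cong (k>n⇒nCk≡0 (ℕ.n<1+n N))) refl) (zeroˡ _)

  sumTo-binomial-S₂ : ∀ N k →
    sumTo (suc N) (λ j → fromℕ (N C j) * fromℕ (S₂ j k)) ≈ fromℕ (S₂ (suc N) (suc k))
  sumTo-binomial-S₂ zero k = begin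
    0# + fromℕ 1 * fromℕ (S₂ 0 k)        ≈⟨ +-identityˡ _ ⟩
    fromℕ 1 * fromℕ (S₂ 0 k)             ≈⟨ trans (*-cong (+-identityʳ 1#) refl) (*-identityˡ _) ⟩
    fromℕ (S₂ 0 k)                       ≈⟨ +-identityˡ _ ⟨
    0# + fromℕ (S₂ 0 k)                  ≈⟨ +-cong (zeroʳ _) refl ⟨
    fromℕ (suc k) * 0# + fromℕ (S₂ 0 k)  ≈⟨ fromℕ-S₂-suc 0 k ⟨
    fromℕ (S₂ 1 (suc k))                 ∎
  sumTo-binomial-S₂ (suc N) zero = begin
    sumTo (suc (suc N)) (λ j → fromℕ (suc N C j) * fromℕ (S₂ j 0))
      ≈⟨ sumTo-binomial-pascal N (λ j → fromℕ (S₂ j 0)) ⟩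
    sumTo (suc N) (λ j → fromℕ (N C j) * 0#) + sumTo (suc N) (λ j → fromℕ (N C j) * fromℕ (S₂ j 0))
      ≈⟨ +-cong (sumTo-zero (suc N) (λ j _ → zeroʳ _)) (sumTo-binomial-S₂ N 0) ⟩
    0# + a                          ≈⟨ +-identityˡ a ⟩
    a                               ≈⟨ *-identityˡ a ⟨
    1# * a                          ≈⟨ *-cong (+-identityʳ 1#) refl ⟨
    fromℕ 1 * a                     ≈⟨ +-identityʳ _ ⟨
    fromℕ 1 * a + 0#                ≈⟨ fromℕ-S₂-suc (suc N) 0 ⟨
    fromℕ (S₂ (suc (suc N)) 1)      ∎
    where
    a : K
    a = fromℕ (S₂ (suc N) 1)
  sumTo-binomial-S₂ (suc N) (suc k) = begin
    sumTo (suc (suc N)) (λ j → fromℕ (suc N C j) * fromℕ (S₂ j (suc k)))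
      ≈⟨ sumTo-binomial-pascal N (λ j → fromℕ (S₂ j (suc k))) ⟩
    sumTo (suc N) (λ j → fromℕ (N C j) * fromℕ (S₂ (suc j) (suc k))) + binomial (suc k)
      ≈⟨ +-cong (trans (sumTo-cong (suc N) distrib-S₂) (sumTo-+ (suc N))) (sumTo-binomial-S₂ N (suc k)) ⟩
    (sumTo (suc N) (λ j → q * (fromℕ (N C j) * fromℕ (S₂ j (suc k)))) + binomial k) + a
      ≈⟨ +-cong (+-cong (sym (*-distribˡ-sumTo (suc N) q)) refl) refl ⟩
    (q * binomial (suc k) + binomial k) + a
      ≈⟨ +-cong (+-cong (*-cong refl (sumTo-binomial-S₂ N (suc k))) (sumTo-binomial-S₂ N k)) refl ⟩
    (q * a + b) + a
      ≈⟨ collect q a b ⟩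
    (1# + q) * a + b
      ≈⟨ fromℕ-S₂-suc (suc N) (suc k) ⟨
    fromℕ (S₂ (suc (suc N)) (suc (suc k))) ∎
    where
    q a b : K
    q = fromℕ (suc k)
    a = fromℕ (S₂ (suc N) (suc (suc k)))
    b = fromℕ (S₂ (suc N) (suc k))
    binomial : ℕ → K
    binomial k = sumTo (suc N) (λ j → fromℕ (N C j) * fromℕ (S₂ j k))
    collect : ∀ q a b → (q * a + b) + a ≈ (1# + q) * a + b
    collect = solve 3 (λ q a b → (q :* a :+ b) :+ a := (con 1 :+ q) :* a :+ b) refl
    distrib-S₂ : ∀ j → fromℕ (N C j) * fromℕ (S₂ (suc j) (suc k)) ≈
                 q * (fromℕ (N C j) * fromℕ (S₂ j (suc k))) + fromℕ (N C j) * fromℕ (S₂ j k)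
    distrib-S₂ j = trans (*-cong refl (fromℕ-S₂-suc j k)) (distrib-scaled _ _ _ _)
      where
      distrib-scaled : ∀ c q x y → c * (q * x + y) ≈ q * (c * x) + c * y
      distrib-scaled = solve 4 (λ c q x y → c :* (q :* x :+ y) := q :* (c :* x) :+ c :* y) refl

  sumTo-binomial-S₂-< : ∀ N k →
    sumTo N (λ j → fromℕ (N C j) * fromℕ (S₂ j k)) ≈ fromℕ (suc k) * fromℕ (S₂ N (suc k))
  sumTo-binomial-S₂-< N k = ∙-cancelʳ (fromℕ (S₂ N k)) _ _ (begin
    sumTo N g + fromℕ (S₂ N k)              ≈⟨ +-cong refl (*-identityˡ _) ⟨
    sumTo N g + 1# * fromℕ (S₂ N k)         ≈⟨ +-cong refl (*-cong nCn≈1 refl) ⟨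
    sumTo (suc N) g                         ≈⟨ sumTo-binomial-S₂ N k ⟩
    fromℕ (S₂ (suc N) (suc k))              ≈⟨ fromℕ-S₂-suc N k ⟩
    fromℕ (suc k) * fromℕ (S₂ N (suc k)) + fromℕ (S₂ N k) ∎)
    where
    g : ℕ → K
    g j = fromℕ (N C j) * fromℕ (S₂ j k)
    nCn≈1 : fromℕ (N C N) ≈ 1#
    nCn≈1 = trans (fromℕ-cong (nCn≡1 N)) (+-identityʳ 1#)

  sumTo-binomial-S₂-from : ∀ s l →
    sumTo (suc l) (λ i → fromℕ ((s +ℕ suc l) C (s +ℕ i)) * fromℕ (S₂ (s +ℕ i) s)) ≈
    fromℕ (suc s) * fromℕ (S₂ (s +ℕ suc l) (suc s))
  sumTo-binomial-S₂-from s l = begin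
    sumTo (suc l) (λ i → g (s +ℕ i))              ≈⟨ +-identityˡ _ ⟨
    0# + sumTo (suc l) (λ i → g (s +ℕ i))         ≈⟨ +-cong (sumTo-zero s g[j<s]≈0) refl ⟨
    sumTo s g + sumTo (suc l) (λ i → g (s +ℕ i))  ≈⟨ sumTo-split s (suc l) ⟨
    sumTo (s +ℕ suc l) g                          ≈⟨ sumTo-binomial-S₂-< (s +ℕ suc l) s ⟩
    fromℕ (suc s) * fromℕ (S₂ (s +ℕ suc l) (suc s)) ∎
    where
    g : ℕ → K
    g j = fromℕ ((s +ℕ suc l) C j) * fromℕ (S₂ j s)
    g[j<s]≈0 : ∀ j → j < s → g j ≈ 0#
    g[j<s]≈0 j j<s = trans (*-cong refl (fromℕ-cong (S₂-< j<s))) (zeroʳ _)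

  fact-*-⊛-expm1/t : ∀ s l f →
    fact (s +ℕ suc l) * (f ⊛ expm1/t) l ≈
    sumTo (suc l) (λ i → fromℕ ((s +ℕ suc l) C (s +ℕ i)) * (fact (s +ℕ i) * f i))
  fact-*-⊛-expm1/t s l f = trans (*-distribˡ-sumTo (suc l) (fact M))
                                 (sumTo-cong-< (suc l) (λ i i≤l → term i (s≤s⁻¹ i≤l)))
    where
    M : ℕ
    M = s +ℕ suc l
    regroup : ∀ b u v x y → (b * (u * v)) * (x * y) ≈ (b * (u * x)) * (v * y)
    regroup = solve 5 (λ b u v x y → (b :* (u :* v)) :* (x :* y) := (b :* (u :* x)) :* (v :* y)) refl
    term : ∀ i → i ≤ l → fact M * (f i * expm1/t (l ∸ i)) ≈ fromℕ (M C (s +ℕ i)) * (fact (s +ℕ i) * f i)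
    term i i≤l = begin
      fact M * (f i * expm1/t (l ∸ i))
        ≈⟨ *-cong (fact-binomial M (s +ℕ i) (ℕ.+-monoʳ-≤ s (ℕ.m≤n⇒m≤1+n i≤l))) refl ⟩
      (fromℕ (M C (s +ℕ i)) * (fact (s +ℕ i) * fact (M ∸ (s +ℕ i)))) * (f i * expm1/t (l ∸ i))
        ≈⟨ *-cong (*-cong refl (*-cong refl (fromℕ-cong (≡.cong _! M∸[s+i]≡1+l∸i)))) refl ⟩
      (fromℕ (M C (s +ℕ i)) * (fact (s +ℕ i) * fact (suc (l ∸ i)))) * (f i * expm1/t (l ∸ i))
        ≈⟨ regroup _ _ _ _ _ ⟩
      (fromℕ (M C (s +ℕ i)) * (fact (s +ℕ i) * f i)) * (fact (suc (l ∸ i)) * expm1/t (l ∸ i))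
        ≈⟨ *-cong refl (fact-suc-*-expm1/t (l ∸ i)) ⟩
      (fromℕ (M C (s +ℕ i)) * (fact (s +ℕ i) * f i)) * 1#
        ≈⟨ *-identityʳ _ ⟩
      fromℕ (M C (s +ℕ i)) * (fact (s +ℕ i) * f i) ∎
      where
      M∸[s+i]≡1+l∸i : M ∸ (s +ℕ i) ≡ suc (l ∸ i)
      M∸[s+i]≡1+l∸i = ≡.trans (ℕ.[m+n]∸[m+o]≡n∸o s (suc l) i) (ℕ.+-∸-assoc 1 i≤l)

  fact-+-*-powS-expm1/t : ∀ s l →
    fact (s +ℕ l) * powS expm1/t s l ≈ fact s * fromℕ (S₂ (s +ℕ l) s)
  fact-+-*-powS-expm1/t zero    zero    = *-cong refl (sym (+-identityʳ 1#))
  fact-+-*-powS-expm1/t zero    (suc l) = trans (zeroʳ _) (sym (zeroʳ _))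
  fact-+-*-powS-expm1/t (suc s) l = begin
    fact (suc s +ℕ l) * powS expm1/t (suc s) l
      ≈⟨ *-cong (fromℕ-cong (≡.cong _! (ℕ.+-suc s l))) refl ⟨
    fact (s +ℕ suc l) * (powS expm1/t s ⊛ expm1/t) l
      ≈⟨ fact-*-⊛-expm1/t s l (powS expm1/t s) ⟩
    sumTo (suc l) (λ i → fromℕ ((s +ℕ suc l) C (s +ℕ i)) * (fact (s +ℕ i) * powS expm1/t s i))
      ≈⟨ sumTo-cong (suc l) (λ i → trans (*-cong refl (fact-+-*-powS-expm1/t s i)) (x*[y*z]≈y*[x*z] _ _ _)) ⟩
    sumTo (suc l) (λ i → fact s * (fromℕ ((s +ℕ suc l) C (s +ℕ i)) * fromℕ (S₂ (s +ℕ i) s)))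
      ≈⟨ *-distribˡ-sumTo (suc l) (fact s) ⟨
    fact s * sumTo (suc l) (λ i → fromℕ ((s +ℕ suc l) C (s +ℕ i)) * fromℕ (S₂ (s +ℕ i) s))
      ≈⟨ *-cong refl (sumTo-binomial-S₂-from s l) ⟩
    fact s * (fromℕ (suc s) * fromℕ (S₂ (s +ℕ suc l) (suc s)))
      ≈⟨ x*[y*z]≈y*[x*z] _ _ _ ⟩
    fromℕ (suc s) * (fact s * fromℕ (S₂ (s +ℕ suc l) (suc s)))
      ≈⟨ *-assoc _ _ _ ⟨
    (fromℕ (suc s) * fact s) * fromℕ (S₂ (s +ℕ suc l) (suc s))
      ≈⟨ *-cong (fromℕ-* (suc s) (s !)) (fromℕ-cong (≡.cong (λ n → S₂ n (suc s)) (≡.sym (ℕ.+-suc s l)))) ⟨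
    fact (suc s) * fromℕ (S₂ (suc s +ℕ l) (suc s)) ∎

  fact-*-powS-expm1/t : ∀ s l →
    fact l * powS expm1/t s l ≈ (fromℕ ((s +ℕ l) C l)) ⁻¹ * fromℕ (S₂ (l +ℕ s) s)
  fact-*-powS-expm1/t s l = a*x≈y⇒x≈a⁻¹*y _ _ binom≉0 (*-cancelˡ-≉0 _ _ (fact≉0 s) (begin
    fact s * (binom * (fact l * powS expm1/t s l))   ≈⟨ x*[y*[z*w]]≈[y*[z*x]]*w _ _ _ _ ⟩
    (binom * (fact l * fact s)) * powS expm1/t s l   ≈⟨ *-cong fact[s+l]≈ refl ⟨
    fact (s +ℕ l) * powS expm1/t s l                 ≈⟨ fact-+-*-powS-expm1/t s l ⟩
    fact s * fromℕ (S₂ (s +ℕ l) s)                   ≈⟨ *-cong refl (fromℕ-cong (≡.cong (λ n → S₂ n s) (ℕ.+-comm s l))) ⟩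
    fact s * fromℕ (S₂ (l +ℕ s) s)                   ∎))
    where
    binom : K
    binom = fromℕ ((s +ℕ l) C l)
    fact[s+l]≈ : fact (s +ℕ l) ≈ binom * (fact l * fact s)
    fact[s+l]≈ = trans (fact-binomial (s +ℕ l) l (ℕ.m≤n+m l s))
                       (*-cong refl (*-cong refl (fromℕ-cong (≡.cong _! (ℕ.m+n∸n≡m s l)))))
    binom≉0 : ¬ (binom ≈ 0#)
    binom≉0 binom≈0 = fact≉0 (s +ℕ l) (trans fact[s+l]≈ (trans (*-cong binom≈0 refl) (zeroˡ _)))
    x*[y*[z*w]]≈[y*[z*x]]*w : ∀ x y z w → x * (y * (z * w)) ≈ (y * (z * x)) * w
    x*[y*[z*w]]≈[y*[z*x]]*w = solve 4 (λ x y z w → x :* (y :* (z :* w)) := (y :* (z :* x)) :* w) refl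

  -- The Bernoulli expansion

  ⊛-expS-factorise : ∀ A s x →
    A ⊛ expS x ≋ (powS (invS expm1/t) s ⊛ expS x) ⊛ (powS expm1/t s ⊛ A)
  ⊛-expS-factorise A s x = ≋-sym (≋-trans
    (⊛-interchange (powS (invS expm1/t) s) (expS x) (powS expm1/t s) A)
    (≋-trans (⊛-cong _ oneS (expS x ⊛ A) (expS x ⊛ A)
                     (powS-invS-⊛-powS expm1/t expm1/t-0≉0 s) ≋-refl)
             (≋-trans (⊛-identityˡ (expS x ⊛ A)) (⊛-comm (expS x) A))))

  fact-*-powS-expm1/t-⊛ : ∀ s f j →
    fact j * (powS expm1/t s ⊛ f) j ≈
      sumTo (suc j) (λ l → fromℕ (j C l) * (fromℕ ((s +ℕ l) C l)) ⁻¹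
        * fromℕ (S₂ (l +ℕ s) s) * (fact (j ∸ l) * f (j ∸ l)))
  fact-*-powS-expm1/t-⊛ s f j = trans (fact-*-⊛ (powS expm1/t s) f j) (sumTo-cong (suc j) (λ l →
    trans (*-cong (*-cong refl (fact-*-powS-expm1/t s l)) refl) (*-cong (sym (*-assoc _ _ _)) refl)))

  bernoulli-expansion : ∀ A s x n →
    fact n * (A ⊛ expS x) n ≈
      sumTo (suc n) (λ m →
        (fromℕ (n C m) *
          sumTo (suc (n ∸ m)) (λ l →
            fromℕ ((n ∸ m) C l) * (fromℕ ((s +ℕ l) C l)) ⁻¹
              * fromℕ (S₂ (l +ℕ s) s) * (fact (n ∸ m ∸ l) * (A ⊛ expS 0#) (n ∸ m ∸ l))))
        * B s m x)
  bernoulli-expansion A s x n = begin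
    fact n * (A ⊛ expS x) n
      ≈⟨ *-cong refl (⊛-expS-factorise A s x n) ⟩
    fact n * (bernoulliS ⊛ (powS expm1/t s ⊛ A)) n
      ≈⟨ fact-*-⊛ bernoulliS (powS expm1/t s ⊛ A) n ⟩
    sumTo (suc n) (λ m → fromℕ (n C m) * B s m x * (fact (n ∸ m) * (powS expm1/t s ⊛ A) (n ∸ m)))
      ≈⟨ sumTo-cong (suc n) (λ m → trans ([x*y]*z≈[x*z]*y _ _ _) (*-cong (*-cong refl (inner (n ∸ m))) refl)) ⟩
    _ ∎
    where
    bernoulliS : FPS
    bernoulliS = powS (invS expm1/t) s ⊛ expS x
    inner : ∀ j → fact j * (powS expm1/t s ⊛ A) j ≈
      sumTo (suc j) (λ l → fromℕ (j C l) * (fromℕ ((s +ℕ l) C l)) ⁻¹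
        * fromℕ (S₂ (l +ℕ s) s) * (fact (j ∸ l) * (A ⊛ expS 0#) (j ∸ l)))
    inner j = trans (*-cong refl (⊛-cong (powS expm1/t s) (powS expm1/t s) A (A ⊛ expS 0#)
                                         ≋-refl (≋-sym (⊛-expS-0# A)) j))
                    (fact-*-powS-expm1/t-⊛ s (A ⊛ expS 0#) j)

theorem7 : ∀ {c ℓ} (F : CharZeroField c ℓ) →
  let open CharZeroField F
      open CommutativeRing cring
      open Series F
  in (λ' x : K) → ¬ (λ' ≈ 1#) → (r k : ℤ) (s n : ℕ) →
     T λ' r k n x ≈
       sumTo (suc n) (λ m →
         (fromℕ (n C m) *
           sumTo (suc (n ∸ m)) (λ l →
             fromℕ ((n ∸ m) C l) * (fromℕ ((s +ℕ l) C l)) ⁻¹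
               * fromℕ (S₂ (l +ℕ s) s) * T₀ λ' r k (n ∸ m ∸ l)))
         * B s m x)
theorem7 F λ' x _ r k s n = bernoulli-expansion F A s x n
  where
  open CharZeroField F
  open CommutativeRing cring
  open Series F
  A : FPS
  A = zpowS (scalS (1# - λ') (invS (expS 1# ⊖ constS λ'))) r
        ⊛ compS (divT (Li k)) (oneS ⊖ expS (- 1#))
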